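{- Let $t : \mathbb{N} \to \mathbb{N}$ be a C-recursive sequence whose generating function is $\sum_{n \geq 0} t(n) z^n = A(z)/B(z)$ with $A, B \in \mathbb{Z}[x]$, $B(x) = 1 + a_1 x + \dots + a_d x^d$, $a_d \neq 0$, $\deg A < \deg B = d$, and the free terms of $A$ and $B$ positive. Put $\tilde A(x) = x^d A(1/x)$ and $\tilde B(x) = x^d B(1/x)$ (so $\tilde A, \tilde B \in \mathbb{Z}[x]$), and let $\alpha_d$ denote the free (constant) term of $\tilde B$. Suppose there is $c \in \mathbb{N}$ such that for all integers $n \geq 1$, $$t(n) = \left\lfloor \frac{c^{n^2} \tilde A(c^n)}{\tilde B(c^n)} \right\rfloor \bmod c^n.$$ If $\alpha_d < 0$, then there is a natural number $e$ such that for all $n \geq 1$: $$t(n) = \frac{1}{|\alpha_d|}\left( \left( \left(e^{n^2} \tilde A(e^n)\right) \bmod \tilde B(e^n) \right) \bmod e^n \right).$$ If $\alpha_d > 0$, then there is a natural number $e$ such that for all $n \geq 1$: $$t(n) = -1 + \frac{1}{\alpha_d}\left( \left( \left(- e^{n^2} \tilde A(e^n)\right) \bmod \tilde B(e^n) \right) \bmod e^n \right).$$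
   Context: $\mathbb{N}$ includes $0$. A sequence $t:\mathbb{N}\to\mathbb{C}$ is C-recursive of order $d$ if $t(n+d) + a_1 t(n+d-1) + \dots + a_d t(n) = 0$ for all $n \in \mathbb{N}$, with constant coefficients $a_i$. For integers $x$ and $m \geq 1$, $x \bmod m$ denotes the least nonnegative residue of $x$ modulo $m$. $\lfloor \cdot \rfloor$ is the floor function. -}

module Defs where

open import Data.Nat as ℕ using (ℕ; zero; suc; _∸_)
open import Relation.Binary.PropositionalEquality using (_≡_)
open import Data.Integer using (ℤ; +_; -[1+_]; _+_; _*_; -_; _^_; _/ℕ_; _%ℕ_)

sumTo : ℕ → (ℕ → ℤ) → ℤ
sumTo zero    f = f 0
sumTo (suc n) f = sumTo n f + f (suc n)

evalPoly : ℕ → (ℕ → ℤ) → ℤ → ℤ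
evalPoly d P x = sumTo d (λ i → P i * (x ^ i))

-- Reversed polynomial  P~(x) = x^d P(1/x) = Σ_{i=0}^{d} P_i x^(d-i)
evalRev : ℕ → (ℕ → ℤ) → ℤ → ℤ
evalRev d P x = sumTo d (λ i → P i * (x ^ (d ∸ i)))

-- ⌊ a / b ⌋ (floor of the rational a/b) for b ≠ 0; junk value 0 when b = 0
-- (only ever used under the hypothesis b ≠ 0).
floorDiv : ℤ → ℤ → ℤ
floorDiv a (+ zero)    = + 0
floorDiv a (+ (suc n)) = a /ℕ suc n
floorDiv a -[1+ n ]    = (- a) /ℕ suc n

-- x mod m : least nonnegative residue of x modulo m, for m ≥ 1;
-- junk value 0 when m ≤ 0 (only ever used under the hypothesis m ≥ 1).
modℤ : ℤ → ℤ → ℤ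
modℤ x (+ zero)    = + 0
modℤ x (+ (suc n)) = + (x %ℕ suc n)
modℤ x -[1+ n ]    = + 0

-- Formal power series identity  (Σ_n t(n) z^n) · B(z) = A(z), i.e.
-- Σ t(n) z^n = A(z)/B(z) (B has constant term 1, hence is invertible):
-- for all n, Σ_{i=0}^{n} B_i t(n-i) = A_n.
GenFun : (ℕ → ℕ) → (ℕ → ℤ) → (ℕ → ℤ) → Set
GenFun t A B = ∀ n → sumTo n (λ i → B i * + (t (n ∸ i))) ≡ A n

{-# OPTIONS --safe #-}

-- Write x = e^n.  Since Σ_k t k z^k = A/B, dividing x^n Ã(x) by B̃(x) leaves the quotient
-- Σ_{k≤n} t k x^(n-k) and the remainder R_n = Σ_{i≤d} B i · N_{d-i}, where N_L is the base-x numeral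
-- with digits t (n+1), …, t (n+L).  As t grows at most exponentially, e can be chosen so that all
-- these digits are tiny compared with x.  Then x^d R_n = R_{n+d} + B̃(x) N_d with |R_{n+d}| + N_d < x^d
-- forces 0 ≤ R_n < B̃(x), and R_n ≠ 0 because t never vanishes at d consecutive indices (B d ≠ 0 and
-- t 0 = A 0 > 0).  Hence x^n Ã mod B̃ = R_n and (-x^n Ã) mod B̃ = B̃ - R_n, which are congruent modulo x
-- to -B d · t n and B d · (t n + 1); these lie in [0, x) when B d < 0, resp. B d > 0.

module Submission where

open import Defs
open import Data.Nat as ℕ using (ℕ; zero; suc)
open import Data.Integer using (ℤ; +_; -_; _+_; _*_; _^_; _<_; ∣_∣)
open import Data.Product using (Σ; _×_; _,_)
open import Relation.Binary.PropositionalEquality using (_≡_; _≢_)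

open import Data.Nat.Base using (_∸_; z≤n; s≤s)
import Data.Nat.Properties as ℕ
open import Data.Nat.Induction using (<-rec)
open import Data.Integer.Base using (-[1+_]; _-_; _⊖_; _≤_; +≤+; +<+; -<+; _%ℕ_; _/ℕ_)
import Data.Integer.Properties as ℤ
open import Data.Integer.DivMod using (a≡a%ℕn+[a/ℕn]*n; n%ℕd<d)
open import Data.Integer.Tactic.RingSolver using (solve-∀)
open import Data.Nat.Tactic.RingSolver using () renaming (solve-∀ to ℕ-solve-∀)
open import Data.Empty using (⊥-elim)
open import Data.Sum using (inj₁; inj₂; fromInj₂)
open import Function using (_∘_)
open import Relation.Nullary using (¬_; yes; no)
open import Relation.Binary.PropositionalEquality
  using (refl; sym; trans; cong; cong₂; subst; module ≡-Reasoning)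

-- Finite sums

sumTo-cong : ∀ n {f g : ℕ → ℤ} → (∀ i → i ℕ.≤ n → f i ≡ g i) → sumTo n f ≡ sumTo n g
sumTo-cong zero    f≗g = f≗g 0 z≤n
sumTo-cong (suc n) f≗g =
  cong₂ _+_ (sumTo-cong n (λ i i≤n → f≗g i (ℕ.m≤n⇒m≤1+n i≤n))) (f≗g (suc n) ℕ.≤-refl)

sumTo-distrib-+ : ∀ n (f g : ℕ → ℤ) → sumTo n (λ i → f i + g i) ≡ sumTo n f + sumTo n g
sumTo-distrib-+ zero    f g = refl
sumTo-distrib-+ (suc n) f g =
  trans (cong (_+ (f (suc n) + g (suc n))) (sumTo-distrib-+ n f g))
        (interchange (sumTo n f) (sumTo n g) (f (suc n)) (g (suc n)))
  where
  interchange : ∀ a b c e → a + b + (c + e) ≡ a + c + (b + e)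
  interchange = solve-∀

sumTo-*ˡ : ∀ n k (f : ℕ → ℤ) → sumTo n (λ i → k * f i) ≡ k * sumTo n f
sumTo-*ˡ zero    k f = refl
sumTo-*ˡ (suc n) k f =
  trans (cong (_+ k * f (suc n)) (sumTo-*ˡ n k f)) (sym (ℤ.*-distribˡ-+ k (sumTo n f) (f (suc n))))

sumTo-*ʳ : ∀ n k (f : ℕ → ℤ) → sumTo n (λ i → f i * k) ≡ sumTo n f * k
sumTo-*ʳ zero    k f = refl
sumTo-*ʳ (suc n) k f =
  trans (cong (_+ f (suc n) * k) (sumTo-*ʳ n k f)) (sym (ℤ.*-distribʳ-+ k (sumTo n f) (f (suc n))))

sumTo-suc : ∀ n (f : ℕ → ℤ) → sumTo (suc n) f ≡ f 0 + sumTo n (λ i → f (suc i))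
sumTo-suc zero    f = refl
sumTo-suc (suc n) f =
  trans (cong (_+ f (suc (suc n))) (sumTo-suc n f)) (ℤ.+-assoc (f 0) _ _)

sumTo-vanishing : ∀ {D} (f : ℕ → ℤ) → (∀ i → D ℕ.< i → f i ≡ + 0) →
                  ∀ {m} → D ℕ.≤ m → sumTo m f ≡ sumTo D f
sumTo-vanishing {D} f f-vanish {m} D≤m with ℕ.m≤n⇒m<n∨m≡n D≤m
... | inj₂ refl = refl
sumTo-vanishing {D} f f-vanish {suc m} D≤m | inj₁ D<1+m =
  trans (cong₂ _+_ (sumTo-vanishing f f-vanish (ℕ.≤-pred D<1+m)) (f-vanish (suc m) D<1+m))
        (ℤ.+-identityʳ (sumTo D f))

sumTo-last : ∀ n {f : ℕ → ℤ} → (∀ i → i ℕ.< n → f i ≡ + 0) → sumTo n f ≡ f n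
sumTo-last zero    _      = refl
sumTo-last (suc n) {f} f<n≡0 = begin
  sumTo n f + f (suc n)   ≡⟨ cong (_+ f (suc n)) (trans (sumTo-last n (λ i i<n → f<n≡0 i (ℕ.m<n⇒m<1+n i<n)))
                                                        (f<n≡0 n ℕ.≤-refl)) ⟩
  + 0 + f (suc n)         ≡⟨ ℤ.+-identityˡ (f (suc n)) ⟩
  f (suc n)               ∎
  where open ≡-Reasoning

sumℕ : ℕ → (ℕ → ℕ) → ℕ
sumℕ zero    w = w 0
sumℕ (suc n) w = sumℕ n w ℕ.+ w (suc n)

sumℕ-mono : ∀ (w : ℕ → ℕ) {m n} → m ℕ.≤ n → sumℕ m w ℕ.≤ sumℕ n w
sumℕ-mono w {m} {n} m≤n with ℕ.m≤n⇒m<n∨m≡n m≤n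
... | inj₂ refl = ℕ.≤-refl
sumℕ-mono w {m} {suc n} m≤n | inj₁ m<1+n =
  ℕ.≤-trans (sumℕ-mono w (ℕ.≤-pred m<1+n)) (ℕ.m≤m+n (sumℕ n w) (w (suc n)))

sumℕ-vanishing : ∀ {D} (w : ℕ → ℕ) → (∀ i → D ℕ.< i → w i ≡ 0) → ∀ n → sumℕ n w ℕ.≤ sumℕ D w
sumℕ-vanishing {D} w w-vanish zero = sumℕ-mono w {n = D} z≤n
sumℕ-vanishing {D} w w-vanish (suc n) with suc n ℕ.≤? D
... | yes 1+n≤D = sumℕ-mono w 1+n≤D
... | no  1+n≰D = begin
  sumℕ n w ℕ.+ w (suc n) ≡⟨ cong (sumℕ n w ℕ.+_) (w-vanish (suc n) (ℕ.≰⇒> 1+n≰D)) ⟩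
  sumℕ n w ℕ.+ 0         ≡⟨ ℕ.+-identityʳ (sumℕ n w) ⟩
  sumℕ n w               ≤⟨ sumℕ-vanishing w w-vanish n ⟩
  sumℕ D w               ∎
  where open ℕ.≤-Reasoning

term≤sumℕ : ∀ (w : ℕ → ℕ) n → w n ℕ.≤ sumℕ n w
term≤sumℕ w zero    = ℕ.≤-refl
term≤sumℕ w (suc n) = ℕ.m≤n+m (w (suc n)) (sumℕ n w)

sumℕ-shift : ∀ (w : ℕ → ℕ) n → sumℕ n (λ i → w (suc i)) ℕ.≤ sumℕ (suc n) w
sumℕ-shift w zero    = ℕ.m≤n+m (w 1) (w 0)
sumℕ-shift w (suc n) = ℕ.+-monoˡ-≤ (w (suc (suc n))) (sumℕ-shift w n)

∣sumTo∣≤ : ∀ n (f : ℕ → ℤ) (w : ℕ → ℕ) {V} → (∀ i → i ℕ.≤ n → ∣ f i ∣ ℕ.≤ w i ℕ.* V) →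
           ∣ sumTo n f ∣ ℕ.≤ sumℕ n w ℕ.* V
∣sumTo∣≤ zero    f w ∣f∣≤ = ∣f∣≤ 0 z≤n
∣sumTo∣≤ (suc n) f w {V} ∣f∣≤ = begin
  ∣ sumTo n f + f (suc n) ∣            ≤⟨ ℤ.∣i+j∣≤∣i∣+∣j∣ (sumTo n f) (f (suc n)) ⟩
  ∣ sumTo n f ∣ ℕ.+ ∣ f (suc n) ∣      ≤⟨ ℕ.+-mono-≤ (∣sumTo∣≤ n f w (λ i i≤n → ∣f∣≤ i (ℕ.m≤n⇒m≤1+n i≤n)))
                                                     (∣f∣≤ (suc n) ℕ.≤-refl) ⟩
  sumℕ n w ℕ.* V ℕ.+ w (suc n) ℕ.* V   ≡⟨ ℕ.*-distribʳ-+ V (sumℕ n w) (w (suc n)) ⟨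
  sumℕ (suc n) w ℕ.* V                 ∎
  where open ℕ.≤-Reasoning

-- Reversed polynomials and base-X numerals

evalRev-suc : ∀ D (c : ℕ → ℤ) x → evalRev (suc D) c x ≡ x * evalRev D c x + c (suc D)
evalRev-suc D c x = cong₂ _+_ lower-terms top-term
  where
  lower-terms : sumTo D (λ i → c i * x ^ (suc D ∸ i)) ≡ x * evalRev D c x
  lower-terms = trans (sumTo-cong D λ i i≤D →
                         trans (cong (λ k → c i * x ^ k) (ℕ.+-∸-assoc 1 i≤D)) (swap (c i) x (x ^ (D ∸ i))))
                      (sumTo-*ˡ D x (λ i → c i * x ^ (D ∸ i)))
    where
    swap : ∀ a y z → a * (y * z) ≡ y * (a * z)
    swap = solve-∀
  top-term : c (suc D) * x ^ (D ∸ D) ≡ c (suc D)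
  top-term = trans (cong (λ k → c (suc D) * x ^ k) (ℕ.n∸n≡0 D)) (ℤ.*-identityʳ (c (suc D)))

evalRev-pad : ∀ D (c : ℕ → ℤ) x → (∀ i → D ℕ.< i → c i ≡ + 0) →
              ∀ N → evalRev (N ℕ.+ D) c x ≡ x ^ N * evalRev D c x
evalRev-pad D c x c-vanish zero    = sym (ℤ.*-identityˡ (evalRev D c x))
evalRev-pad D c x c-vanish (suc N) = begin
  evalRev (suc (N ℕ.+ D)) c x                    ≡⟨ evalRev-suc (N ℕ.+ D) c x ⟩
  x * evalRev (N ℕ.+ D) c x + c (suc (N ℕ.+ D))  ≡⟨ cong₂ (λ p z → x * p + z) (evalRev-pad D c x c-vanish N)
                                                          (c-vanish (suc (N ℕ.+ D)) (s≤s (ℕ.m≤n+m D N))) ⟩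
  x * (x ^ N * evalRev D c x) + + 0              ≡⟨ ℤ.+-identityʳ _ ⟩
  x * (x ^ N * evalRev D c x)                    ≡⟨ ℤ.*-assoc x (x ^ N) (evalRev D c x) ⟨
  x ^ suc N * evalRev D c x                      ∎
  where open ≡-Reasoning

evalRev-convolution : ∀ D (b c : ℕ → ℤ) x →
  evalRev D (λ m → sumTo m (λ i → b i * c (m ∸ i))) x ≡ sumTo D (λ i → b i * evalRev (D ∸ i) c x)
evalRev-convolution zero    b c x = ℤ.*-assoc (b 0) (c 0) (x ^ 0)
evalRev-convolution (suc D) b c x = begin
  evalRev (suc D) conv x
    ≡⟨ evalRev-suc D conv x ⟩
  x * evalRev D conv x + conv (suc D)
    ≡⟨ cong (λ s → x * s + conv (suc D)) (evalRev-convolution D b c x) ⟩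
  x * sumTo D (λ i → b i * E (D ∸ i)) + (sumTo D (λ i → b i * c (suc D ∸ i)) + b (suc D) * c (D ∸ D))
    ≡⟨ ℤ.+-assoc (x * sumTo D (λ i → b i * E (D ∸ i))) _ _ ⟨
  x * sumTo D (λ i → b i * E (D ∸ i)) + sumTo D (λ i → b i * c (suc D ∸ i)) + b (suc D) * c (D ∸ D)
    ≡⟨ cong₂ _+_ lower-terms top-term ⟩
  sumTo D (λ i → b i * E (suc D ∸ i)) + b (suc D) * E (D ∸ D)
    ∎
  where
  open ≡-Reasoning
  conv : ℕ → ℤ
  conv m = sumTo m (λ i → b i * c (m ∸ i))
  E : ℕ → ℤ
  E k = evalRev k c x
  horner-term : ∀ i → i ℕ.≤ D → x * (b i * E (D ∸ i)) + b i * c (suc D ∸ i) ≡ b i * E (suc D ∸ i)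
  horner-term i i≤D rewrite ℕ.+-∸-assoc 1 i≤D =
    trans (factor (b i) x (E (D ∸ i)) (c (suc (D ∸ i)))) (cong (b i *_) (sym (evalRev-suc (D ∸ i) c x)))
    where
    factor : ∀ a y e z → y * (a * e) + a * z ≡ a * (y * e + z)
    factor = solve-∀
  lower-terms : x * sumTo D (λ i → b i * E (D ∸ i)) + sumTo D (λ i → b i * c (suc D ∸ i)) ≡
                sumTo D (λ i → b i * E (suc D ∸ i))
  lower-terms = begin
    x * sumTo D (λ i → b i * E (D ∸ i)) + sumTo D (λ i → b i * c (suc D ∸ i))
      ≡⟨ cong (_+ sumTo D (λ i → b i * c (suc D ∸ i))) (sumTo-*ˡ D x (λ i → b i * E (D ∸ i))) ⟨
    sumTo D (λ i → x * (b i * E (D ∸ i))) + sumTo D (λ i → b i * c (suc D ∸ i))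
      ≡⟨ sumTo-distrib-+ D _ _ ⟨
    sumTo D (λ i → x * (b i * E (D ∸ i)) + b i * c (suc D ∸ i))
      ≡⟨ sumTo-cong D horner-term ⟩
    sumTo D (λ i → b i * E (suc D ∸ i))
      ∎
  top-term : b (suc D) * c (D ∸ D) ≡ b (suc D) * E (D ∸ D)
  top-term rewrite ℕ.n∸n≡0 D = cong (b (suc D) *_) (sym (ℤ.*-identityʳ (c 0)))

pos-^ : ∀ m n → + (m ℕ.^ n) ≡ (+ m) ^ n
pos-^ m zero    = refl
pos-^ m (suc n) = trans (ℤ.pos-* m (m ℕ.^ n)) (cong (+ m *_) (pos-^ m n))

numeral : (ℕ → ℕ) → ℕ → ℕ → ℕ
numeral c zero    X = 0
numeral c (suc L) X = X ℕ.* numeral c L X ℕ.+ c (suc L)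

evalRev-+ : ∀ (c : ℕ → ℕ) L N X →
  evalRev (L ℕ.+ N) (λ k → + c k) (+ X) ≡
  + (X ℕ.^ L) * evalRev N (λ k → + c k) (+ X) + + numeral (λ l → c (N ℕ.+ l)) L X
evalRev-+ c zero    N X = sym (trans (ℤ.+-identityʳ _) (ℤ.*-identityˡ _))
evalRev-+ c (suc L) N X = begin
  evalRev (suc (L ℕ.+ N)) c′ x
    ≡⟨ evalRev-suc (L ℕ.+ N) c′ x ⟩
  x * evalRev (L ℕ.+ N) c′ x + + c (suc (L ℕ.+ N))
    ≡⟨ cong₂ (λ p k → x * p + + c k) (evalRev-+ c L N X) (ℕ.+-comm (suc L) N) ⟩
  x * (+ (X ℕ.^ L) * P + + n) + + c (N ℕ.+ suc L)
    ≡⟨ distrib x (+ (X ℕ.^ L)) P (+ n) (+ c (N ℕ.+ suc L)) ⟩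
  x * + (X ℕ.^ L) * P + (x * + n + + c (N ℕ.+ suc L))
    ≡⟨ cong₂ (λ p m → p * P + m) (ℤ.pos-* X (X ℕ.^ L))
             (trans (ℤ.pos-+ (X ℕ.* n) _) (cong (_+ _) (ℤ.pos-* X n))) ⟨
  + (X ℕ.^ suc L) * P + + numeral (λ l → c (N ℕ.+ l)) (suc L) X
    ∎
  where
  open ≡-Reasoning
  x : ℤ
  x = + X
  c′ : ℕ → ℤ
  c′ k = + c k
  P : ℤ
  P = evalRev N c′ x
  n : ℕ
  n = numeral (λ l → c (N ℕ.+ l)) L X
  distrib : ∀ y z p m k → y * (z * p + m) + k ≡ y * z * p + (y * m + k)
  distrib = solve-∀

digit≤numeral : ∀ (c : ℕ → ℕ) {l} L {X} → 1 ℕ.≤ X → 1 ℕ.≤ l → l ℕ.≤ L → c l ℕ.≤ numeral c L X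
digit≤numeral c {suc l} zero    1≤X 1≤l ()
digit≤numeral c {l}     (suc L) {X} 1≤X 1≤l l≤1+L with ℕ.m≤n⇒m<n∨m≡n l≤1+L
... | inj₂ refl     = ℕ.m≤n+m (c (suc L)) (X ℕ.* numeral c L X)
... | inj₁ l<1+L = begin
  c l                                    ≤⟨ digit≤numeral c L 1≤X 1≤l (ℕ.≤-pred l<1+L) ⟩
  numeral c L X                          ≤⟨ ℕ.m≤n*m (numeral c L X) X {{ℕ.>-nonZero 1≤X}} ⟩
  X ℕ.* numeral c L X                    ≤⟨ ℕ.m≤m+n (X ℕ.* numeral c L X) (c (suc L)) ⟩
  X ℕ.* numeral c L X ℕ.+ c (suc L)      ∎
  where open ℕ.≤-Reasoning

K*numeral<X^L : ∀ (c : ℕ → ℕ) L X K → (∀ l → 1 ℕ.≤ l → l ℕ.≤ L → K ℕ.* c l ℕ.< X) →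
             K ℕ.* numeral c L X ℕ.< X ℕ.^ L
K*numeral<X^L c zero    X K _          = subst (ℕ._< 1) (sym (ℕ.*-zeroʳ K)) (s≤s z≤n)
K*numeral<X^L c (suc L) X K small-digits = begin-strict
  K ℕ.* (X ℕ.* n ℕ.+ c (suc L))      ≡⟨ distrib K X n (c (suc L)) ⟩
  X ℕ.* (K ℕ.* n) ℕ.+ K ℕ.* c (suc L) <⟨ ℕ.+-monoʳ-< (X ℕ.* (K ℕ.* n))
                                                     (small-digits (suc L) (s≤s z≤n) ℕ.≤-refl) ⟩
  X ℕ.* (K ℕ.* n) ℕ.+ X              ≡⟨ trans (ℕ.+-comm (X ℕ.* (K ℕ.* n)) X) (sym (ℕ.*-suc X (K ℕ.* n))) ⟩
  X ℕ.* suc (K ℕ.* n)                ≤⟨ ℕ.*-monoʳ-≤ X (K*numeral<X^L c L X K lower-digits) ⟩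
  X ℕ.* X ℕ.^ L                      ∎
  where
  open ℕ.≤-Reasoning
  lower-digits : ∀ l → 1 ℕ.≤ l → l ℕ.≤ L → K ℕ.* c l ℕ.< X
  lower-digits l 1≤l l≤L = small-digits l 1≤l (ℕ.m≤n⇒m≤1+n l≤L)
  n : ℕ
  n = numeral c L X
  distrib : ∀ k x m d → k ℕ.* (x ℕ.* m ℕ.+ d) ≡ x ℕ.* (k ℕ.* m) ℕ.+ k ℕ.* d
  distrib = ℕ-solve-∀

-- Remainders and integer estimates

remainder-unique : ∀ {M r r′} (q q′ : ℤ) → r ℕ.< M → r′ ℕ.< M →
                   q * + M + + r ≡ q′ * + M + + r′ → r ≡ r′
remainder-unique {M} {r} {r′} q q′ r<M r′<M eq =
  sym (ℤ.+-injective (ℤ.i-j≡0⇒i≡j (+ r′) (+ r) (trans (sym δM≡r′-r) δM≡0)))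
  where
  expand : ∀ q q′ m r → (q - q′) * m ≡ q * m + r - (q′ * m + r)
  expand = solve-∀
  cancel : ∀ a r′ r → a + r′ - (a + r) ≡ r′ - r
  cancel = solve-∀
  δM≡r′-r : (q - q′) * + M ≡ + r′ - + r
  δM≡r′-r = begin
    (q - q′) * + M                      ≡⟨ expand q q′ (+ M) (+ r) ⟩
    q * + M + + r - (q′ * + M + + r)    ≡⟨ cong (_- (q′ * + M + + r)) eq ⟩
    q′ * + M + + r′ - (q′ * + M + + r)  ≡⟨ cancel (q′ * + M) (+ r′) (+ r) ⟩
    + r′ - + r                          ∎
    where open ≡-Reasoning
  ∣δ∣*M<1*M : ∣ q - q′ ∣ ℕ.* M ℕ.< 1 ℕ.* M
  ∣δ∣*M<1*M = begin-strict
    ∣ q - q′ ∣ ℕ.* M    ≡⟨ ℤ.abs-* (q - q′) (+ M) ⟨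
    ∣ (q - q′) * + M ∣  ≡⟨ cong ∣_∣ (trans δM≡r′-r (ℤ.[+m]-[+n]≡m⊖n r′ r)) ⟩
    ∣ r′ ⊖ r ∣          ≤⟨ ℤ.∣m⊝n∣≤m⊔n r′ r ⟩
    r′ ℕ.⊔ r            <⟨ ℕ.⊔-lub r′<M r<M ⟩
    M                   ≡⟨ ℕ.*-identityˡ M ⟨
    1 ℕ.* M             ∎
    where open ℕ.≤-Reasoning
  δM≡0 : (q - q′) * + M ≡ + 0
  δM≡0 = trans (cong (_* + M) (ℤ.∣i∣≡0⇒i≡0 {q - q′} (ℕ.n<1⇒n≡0 (ℕ.*-cancelʳ-< M ∣ q - q′ ∣ 1 ∣δ∣*M<1*M))))
               (ℤ.*-zeroˡ (+ M))

modℤ-unique : ∀ (q : ℤ) {m r : ℤ} → + 0 ≤ r → r < m → modℤ (q * m + r) m ≡ r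
modℤ-unique q {+ suc M} {+ r} _ (+<+ r<M) =
  cong +_ (remainder-unique (y /ℕ suc M) q (n%ℕd<d y (suc M)) r<M
            (trans (ℤ.+-comm ((y /ℕ suc M) * + suc M) (+ (y %ℕ suc M)))
                   (sym (a≡a%ℕn+[a/ℕn]*n y (suc M)))))
  where
  y : ℤ
  y = q * + suc M + + r
modℤ-unique q {+ zero}   {+ r} _ (+<+ ())
modℤ-unique q { -[1+ _ ]} {+ r} _ ()

p*u≡v+w⇒0≤u : ∀ p {u v w : ℤ} → + p * u ≡ v + w → ∣ v ∣ ℕ.< p → + 0 ≤ w → + 0 ≤ u
p*u≡v+w⇒0≤u p {+ _} _ _ _ = +≤+ z≤n
p*u≡v+w⇒0≤u p { -[1+ k ]} {v} {+ w} eq ∣v∣<p _ = ⊥-elim (ℕ.<⇒≱ ∣v∣<p p≤∣v∣)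
  where
  isolate : ∀ p s v w → p * (- s) ≡ v + w → v ≡ - (p * s + w)
  isolate p s v w eq = trans (solve₁ v w) (trans (cong (_- w) (sym eq)) (solve₂ p s w))
    where
    solve₁ : ∀ v w → v ≡ (v + w) - w
    solve₁ = solve-∀
    solve₂ : ∀ p s w → p * (- s) - w ≡ - (p * s + w)
    solve₂ = solve-∀
  ∣v∣≡ : ∣ v ∣ ≡ p ℕ.* suc k ℕ.+ w
  ∣v∣≡ = begin
    ∣ v ∣                           ≡⟨ cong ∣_∣ (isolate (+ p) (+ suc k) v (+ w) eq) ⟩
    ∣ - (+ p * + suc k + + w) ∣     ≡⟨ ℤ.∣-i∣≡∣i∣ (+ p * + suc k + + w) ⟩
    ∣ + p * + suc k + + w ∣         ≡⟨ cong (λ z → ∣ z + + w ∣) (ℤ.pos-* p (suc k)) ⟨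
    p ℕ.* suc k ℕ.+ w               ∎
    where open ≡-Reasoning
  p≤∣v∣ : p ℕ.≤ ∣ v ∣
  p≤∣v∣ = ℕ.≤-trans (ℕ.m≤m*n p (suc k)) (ℕ.≤-trans (ℕ.m≤m+n (p ℕ.* suc k) w) (ℕ.≤-reflexive (sym ∣v∣≡)))

p*u≡v+b*w⇒u<b : ∀ p {u v b : ℤ} {w : ℕ} → + p * u ≡ v + b * + w → ∣ v ∣ ℕ.+ w ℕ.< p → + 0 < b → u < b
p*u≡v+b*w⇒u<b p { -[1+ _ ]} {b = + _} _ _ _ = -<+
p*u≡v+b*w⇒u<b p {+ u} {v} {+ b} {w} eq small (+<+ 0<b) with u ℕ.<? b
... | yes u<b = +<+ u<b
... | no  u≮b = ⊥-elim (ℕ.<-irrefl (ℕ.*-comm p b) (begin-strict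
  p ℕ.* b                       ≤⟨ ℕ.*-monoʳ-≤ p (ℕ.≮⇒≥ u≮b) ⟩
  p ℕ.* u                       ≡⟨ trans (cong ∣_∣ (sym eq)) (ℤ.abs-* (+ p) (+ u)) ⟨
  ∣ v + + b * + w ∣             ≤⟨ ℤ.∣i+j∣≤∣i∣+∣j∣ v (+ b * + w) ⟩
  ∣ v ∣ ℕ.+ ∣ + b * + w ∣       ≡⟨ cong (∣ v ∣ ℕ.+_) (ℤ.abs-* (+ b) (+ w)) ⟩
  ∣ v ∣ ℕ.+ b ℕ.* w             ≤⟨ ℕ.+-monoˡ-≤ (b ℕ.* w) (ℕ.m≤n*m ∣ v ∣ b {{ℕ.>-nonZero 0<b}}) ⟩
  b ℕ.* ∣ v ∣ ℕ.+ b ℕ.* w       ≡⟨ ℕ.*-distribˡ-+ b ∣ v ∣ w ⟨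
  b ℕ.* (∣ v ∣ ℕ.+ w)           <⟨ ℕ.*-monoʳ-< b {{ℕ.>-nonZero 0<b}} small ⟩
  b ℕ.* p                       ∎))
  where open ℕ.≤-Reasoning

v+b*w≡0⇒w≡0 : ∀ {v b : ℤ} {w : ℕ} → + 0 ≤ v → + 0 < b → v + b * + w ≡ + 0 → w ≡ 0
v+b*w≡0⇒w≡0 {+ v} {+ suc b} {w} _ _ eq =
  ℕ.m*n≡0⇒m≡0 w (suc b) (trans (ℕ.*-comm w (suc b)) (ℕ.m+n≡0⇒n≡0 v (ℤ.+-injective v+b*w≡0)))
  where
  v+b*w≡0 : + (v ℕ.+ suc b ℕ.* w) ≡ + 0
  v+b*w≡0 = trans (ℤ.pos-+ v (suc b ℕ.* w)) (trans (cong (_+_ (+ v)) (ℤ.pos-* (suc b) w)) eq)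
v+b*w≡0⇒w≡0 {+ v} {+ zero} _ (+<+ ()) _

∣i∣<p⇒0<p+i : ∀ p (i : ℤ) → ∣ i ∣ ℕ.< p → + 0 < + p + i
∣i∣<p⇒0<p+i p (+ e)      e<p   = +<+ (ℕ.≤-trans (ℕ.m<n⇒0<n e<p) (ℕ.m≤m+n p e))
∣i∣<p⇒0<p+i p -[1+ e ] 1+e<p = subst (+ 0 <_) (sym (ℤ.⊖-≥ (ℕ.<⇒≤ 1+e<p))) (+<+ (ℕ.m<n⇒0<n∸m 1+e<p))

i<0⇒-i≡+∣i∣ : ∀ {i} → i < + 0 → - i ≡ + ∣ i ∣
i<0⇒-i≡+∣i∣ { -[1+ _ ]} _       = refl
i<0⇒-i≡+∣i∣ {+ _}      (+<+ ())

0≤i⇒0≤i*n : ∀ {i} n → + 0 ≤ i → + 0 ≤ i * + n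
0≤i⇒0≤i*n {+ i} n _ = subst (+ 0 ≤_) (ℤ.pos-* i n) (+≤+ z≤n)

m+n*o<[1+m+n]*o : ∀ m n o → 1 ℕ.≤ o → m ℕ.+ n ℕ.* o ℕ.< suc (m ℕ.+ n) ℕ.* o
m+n*o<[1+m+n]*o m n o 1≤o = begin-strict
  m ℕ.+ n ℕ.* o             <⟨ ℕ.+-monoˡ-< (n ℕ.* o) (ℕ.n<1+n m) ⟩
  suc m ℕ.+ n ℕ.* o         ≤⟨ ℕ.+-monoˡ-≤ (n ℕ.* o) (ℕ.m≤m*n (suc m) o {{ℕ.>-nonZero 1≤o}}) ⟩
  suc m ℕ.* o ℕ.+ n ℕ.* o   ≡⟨ ℕ.*-distribʳ-+ o (suc m) n ⟨
  suc (m ℕ.+ n) ℕ.* o       ∎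
  where open ℕ.≤-Reasoning

a*c^n<[[1+a]*c]^n : ∀ a c N → a ℕ.* suc c ℕ.^ suc N ℕ.< (suc a ℕ.* suc c) ℕ.^ suc N
a*c^n<[[1+a]*c]^n a c N =
  ℕ.<-≤-trans (ℕ.*-monoˡ-< (suc c ℕ.^ suc N) {{ℕ.m^n≢0 (suc c) (suc N)}} (ℕ.n<1+n a)) (lift N)
  where
  lift : ∀ N → suc a ℕ.* suc c ℕ.^ suc N ℕ.≤ (suc a ℕ.* suc c) ℕ.^ suc N
  lift zero    = ℕ.≤-reflexive (sym (ℕ.*-assoc (suc a) (suc c) 1))
  lift (suc N) = begin
    suc a ℕ.* (suc c ℕ.* suc c ℕ.^ suc N)            ≡⟨ ℕ.*-assoc (suc a) (suc c) (suc c ℕ.^ suc N) ⟨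
    suc a ℕ.* suc c ℕ.* suc c ℕ.^ suc N              ≤⟨ ℕ.*-monoʳ-≤ (suc a ℕ.* suc c)
                                                                      (ℕ.m≤n*m (suc c ℕ.^ suc N) (suc a)) ⟩
    suc a ℕ.* suc c ℕ.* (suc a ℕ.* suc c ℕ.^ suc N)  ≤⟨ ℕ.*-monoʳ-≤ (suc a ℕ.* suc c) (lift N) ⟩
    (suc a ℕ.* suc c) ℕ.^ suc (suc N)                ∎
    where open ℕ.≤-Reasoning

module Recurrence
  (d′ : ℕ) (A B : ℕ → ℤ) (t : ℕ → ℕ)
  (B₀≡1 : B 0 ≡ + 1) (B-top≢0 : B (suc d′) ≢ + 0)
  (B-vanish : ∀ i → suc d′ ℕ.< i → B i ≡ + 0) (A-vanish : ∀ i → suc d′ ℕ.≤ i → A i ≡ + 0)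
  (A₀>0 : + 0 < A 0) (gf : GenFun t A B)
  where

  d : ℕ
  d = suc d′

  T : ℕ → ℤ
  T k = + t k

  Ã B̃ : ℤ → ℤ
  Ã = evalRev d A
  B̃ = evalRev d B

  P : ℕ → ℤ → ℤ
  P N = evalRev N T

  -- P N x = Σ_{k ≤ N} t k x^(N-k) is the polynomial part of x^N Ã(x)/B̃(x) = Σ_k t k x^(N-k),
  -- so R N is the remainder of x^N Ã on division by B̃.
  R : ℕ → ℤ → ℤ
  R N x = x ^ N * Ã x - B̃ x * P N x

  x^M*Ã≡B̃*P+numerals : ∀ M X →
    (+ X) ^ M * Ã (+ X) ≡
    B̃ (+ X) * P M (+ X) + sumTo d (λ i → B i * + numeral (λ l → t (M ℕ.+ l)) (d ∸ i) X)
  x^M*Ã≡B̃*P+numerals M X = begin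
    x ^ M * Ã x
      ≡⟨ evalRev-pad d A x (λ i d<i → A-vanish i (ℕ.<⇒≤ d<i)) M ⟨
    evalRev (M ℕ.+ d) A x
      ≡⟨ sumTo-cong (M ℕ.+ d) (λ m _ → cong (_* x ^ (M ℕ.+ d ∸ m)) (sym (gf m))) ⟩
    evalRev (M ℕ.+ d) (λ m → sumTo m (λ i → B i * T (m ∸ i))) x
      ≡⟨ evalRev-convolution (M ℕ.+ d) B T x ⟩
    sumTo (M ℕ.+ d) (λ i → B i * P (M ℕ.+ d ∸ i) x)
      ≡⟨ sumTo-vanishing _ (λ i d<i → trans (cong (_* P (M ℕ.+ d ∸ i) x) (B-vanish i d<i))
                                                (ℤ.*-zeroˡ (P (M ℕ.+ d ∸ i) x)))
                         (ℕ.m≤n+m d M) ⟩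
    sumTo d (λ i → B i * P (M ℕ.+ d ∸ i) x)
      ≡⟨ sumTo-cong d split ⟩
    sumTo d (λ i → B i * x ^ (d ∸ i) * P M x + B i * + n i)
      ≡⟨ sumTo-distrib-+ d _ _ ⟩
    sumTo d (λ i → B i * x ^ (d ∸ i) * P M x) + sumTo d (λ i → B i * + n i)
      ≡⟨ cong (_+ sumTo d (λ i → B i * + n i)) (sumTo-*ʳ d (P M x) (λ i → B i * x ^ (d ∸ i))) ⟩
    B̃ x * P M x + sumTo d (λ i → B i * + n i)
      ∎
    where
    open ≡-Reasoning
    x : ℤ
    x = + X
    n : ℕ → ℕ
    n i = numeral (λ l → t (M ℕ.+ l)) (d ∸ i) X
    distrib : ∀ b y p m → b * (y * p + m) ≡ b * y * p + b * m
    distrib = solve-∀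
    split : ∀ i → i ℕ.≤ d → B i * P (M ℕ.+ d ∸ i) x ≡ B i * x ^ (d ∸ i) * P M x + B i * + n i
    split i i≤d = begin
      B i * P (M ℕ.+ d ∸ i) x
        ≡⟨ cong (λ k → B i * P k x) (trans (cong (_∸ i) (ℕ.+-comm M d)) (ℕ.+-∸-comm M i≤d)) ⟩
      B i * P (d ∸ i ℕ.+ M) x
        ≡⟨ cong (B i *_) (evalRev-+ t (d ∸ i) M X) ⟩
      B i * (+ (X ℕ.^ (d ∸ i)) * P M x + + n i)
        ≡⟨ cong (λ y → B i * (y * P M x + + n i)) (pos-^ X (d ∸ i)) ⟩
      B i * (x ^ (d ∸ i) * P M x + + n i)
        ≡⟨ distrib (B i) (x ^ (d ∸ i)) (P M x) (+ n i) ⟩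
      B i * x ^ (d ∸ i) * P M x + B i * + n i
        ∎

  R≡numerals : ∀ M X → R M (+ X) ≡ sumTo d (λ i → B i * + numeral (λ l → t (M ℕ.+ l)) (d ∸ i) X)
  R≡numerals M X =
    trans (cong (_- B̃ (+ X) * P M (+ X)) (x^M*Ã≡B̃*P+numerals M X)) (cancel (B̃ (+ X) * P M (+ X)) _)
    where
    cancel : ∀ a b → a + b - a ≡ b
    cancel = solve-∀

  R-shift : ∀ L M X →
    + (X ℕ.^ L) * R M (+ X) ≡ R (L ℕ.+ M) (+ X) + B̃ (+ X) * + numeral (λ l → t (M ℕ.+ l)) L X
  R-shift L M X = begin
    + (X ℕ.^ L) * (x ^ M * Ã x - B̃ x * P M x)
      ≡⟨ rearrange (+ (X ℕ.^ L)) (x ^ M) (Ã x) (B̃ x) (P M x) (+ n) ⟩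
    + (X ℕ.^ L) * x ^ M * Ã x - B̃ x * (+ (X ℕ.^ L) * P M x + + n) + B̃ x * + n
      ≡⟨ cong₂ (λ y p → y * Ã x - B̃ x * p + B̃ x * + n)
               (trans (cong (_* x ^ M) (pos-^ X L)) (sym (ℤ.^-distribˡ-+-* x L M)))
               (sym (evalRev-+ t L M X)) ⟩
    x ^ (L ℕ.+ M) * Ã x - B̃ x * P (L ℕ.+ M) x + B̃ x * + n
      ∎
    where
    open ≡-Reasoning
    x : ℤ
    x = + X
    n : ℕ
    n = numeral (λ l → t (M ℕ.+ l)) L X
    rearrange : ∀ y z a b p m → y * (z * a - b * p) ≡ y * z * a - b * (y * p + m) + b * m
    rearrange = solve-∀

  B̃-residue : ∀ x → B̃ x ≡ evalRev d′ B x * x + B d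
  B̃-residue x = trans (evalRev-suc d′ B x) (cong (_+ B d) (ℤ.*-comm x (evalRev d′ B x)))

  R-suc-residue : ∀ N x → R (suc N) x ≡ (R N x - evalRev d′ B x * T (suc N)) * x - B d * T (suc N)
  R-suc-residue N x = begin
    x * x ^ N * Ã x - B̃ x * P (suc N) x
      ≡⟨ cong₂ (λ b p → x * x ^ N * Ã x - b * p) (B̃-residue x) (evalRev-suc N T x) ⟩
    x * x ^ N * Ã x - (W * x + B d) * (x * P N x + T (suc N))
      ≡⟨ expand x (x ^ N) (Ã x) W (B d) (P N x) (T (suc N)) ⟩
    (x ^ N * Ã x - (W * x + B d) * P N x - W * T (suc N)) * x - B d * T (suc N)
      ≡⟨ cong (λ b → (x ^ N * Ã x - b * P N x - W * T (suc N)) * x - B d * T (suc N))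
              (sym (B̃-residue x)) ⟩
    (R N x - W * T (suc N)) * x - B d * T (suc N)
      ∎
    where
    open ≡-Reasoning
    W : ℤ
    W = evalRev d′ B x
    expand : ∀ x y a w b p s →
             x * y * a - (w * x + b) * (x * p + s) ≡ (y * a - (w * x + b) * p - w * s) * x - b * s
    expand = solve-∀

  S H C : ℕ
  S = sumℕ d (λ i → ∣ B i ∣)
  H = sumℕ d (λ i → ∣ A i ∣)
  C = suc (H ℕ.+ S)

  Σ∣B∣≤S : ∀ n → sumℕ n (λ i → ∣ B i ∣) ℕ.≤ S
  Σ∣B∣≤S = sumℕ-vanishing (λ i → ∣ B i ∣) (λ i d<i → cong ∣_∣ (B-vanish i d<i))

  ∣B∣≤S : ∀ i → ∣ B i ∣ ℕ.≤ S
  ∣B∣≤S i = ℕ.≤-trans (term≤sumℕ (λ j → ∣ B j ∣) i) (Σ∣B∣≤S i)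

  ∣A∣≤H : ∀ i → ∣ A i ∣ ℕ.≤ H
  ∣A∣≤H i = ℕ.≤-trans (term≤sumℕ (λ j → ∣ A j ∣) i)
                      (sumℕ-vanishing (λ j → ∣ A j ∣) (λ j d<j → cong ∣_∣ (A-vanish j (ℕ.<⇒≤ d<j))) i)

  T₀≡A₀ : T 0 ≡ A 0
  T₀≡A₀ = trans (sym (trans (cong (_* T 0) B₀≡1) (ℤ.*-identityˡ (T 0)))) (gf 0)

  T-suc : ∀ k → T (suc k) ≡ A (suc k) - sumTo k (λ i → B (suc i) * T (k ∸ i))
  T-suc k = begin
    T (suc k)                                     ≡⟨ isolate (T (suc k)) Σ′ ⟩
    + 1 * T (suc k) + Σ′ - Σ′                     ≡⟨ cong (λ b → b * T (suc k) + Σ′ - Σ′) B₀≡1 ⟨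
    B 0 * T (suc k) + Σ′ - Σ′                     ≡⟨ cong (_- Σ′) (trans (sym (sumTo-suc k _)) (gf (suc k))) ⟩
    A (suc k) - Σ′                                ∎
    where
    open ≡-Reasoning
    Σ′ : ℤ
    Σ′ = sumTo k (λ i → B (suc i) * T (k ∸ i))
    isolate : ∀ a s → a ≡ + 1 * a + s - s
    isolate = solve-∀

  t<C^ : ∀ k → t k ℕ.< C ℕ.^ suc k
  t<C^ = <-rec _ bound
    where
    bound : ∀ k → (∀ {j} → j ℕ.< k → t j ℕ.< C ℕ.^ suc j) → t k ℕ.< C ℕ.^ suc k
    bound zero _ = begin-strict
      t 0          ≡⟨ cong ∣_∣ T₀≡A₀ ⟩
      ∣ A 0 ∣      ≤⟨ ∣A∣≤H 0 ⟩
      H            <⟨ s≤s (ℕ.m≤m+n H S) ⟩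
      C            ≡⟨ ℕ.*-identityʳ C ⟨
      C ℕ.* 1      ∎
      where open ℕ.≤-Reasoning
    bound (suc k) ih = begin-strict
      t (suc k)
        ≡⟨ cong ∣_∣ (T-suc k) ⟩
      ∣ A (suc k) - sumTo k (λ i → B (suc i) * T (k ∸ i)) ∣
        ≤⟨ ℤ.∣i-j∣≤∣i∣+∣j∣ (A (suc k)) _ ⟩
      ∣ A (suc k) ∣ ℕ.+ ∣ sumTo k (λ i → B (suc i) * T (k ∸ i)) ∣
        ≤⟨ ℕ.+-mono-≤ (∣A∣≤H (suc k)) (∣sumTo∣≤ k _ (λ i → ∣ B (suc i) ∣) term-bound) ⟩
      H ℕ.+ sumℕ k (λ i → ∣ B (suc i) ∣) ℕ.* C ℕ.^ suc k
        ≤⟨ ℕ.+-monoʳ-≤ H (ℕ.*-monoˡ-≤ (C ℕ.^ suc k) (ℕ.≤-trans (sumℕ-shift _ k) (Σ∣B∣≤S (suc k)))) ⟩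
      H ℕ.+ S ℕ.* C ℕ.^ suc k
        <⟨ m+n*o<[1+m+n]*o H S (C ℕ.^ suc k) (ℕ.m^n>0 C (suc k)) ⟩
      C ℕ.* C ℕ.^ suc k
        ∎
      where
      open ℕ.≤-Reasoning
      term-bound : ∀ i → i ℕ.≤ k → ∣ B (suc i) * T (k ∸ i) ∣ ℕ.≤ ∣ B (suc i) ∣ ℕ.* C ℕ.^ suc k
      term-bound i _ = ℕ.≤-trans (ℕ.≤-reflexive (ℤ.abs-* (B (suc i)) (T (k ∸ i))))
        (ℕ.*-monoʳ-≤ ∣ B (suc i) ∣ (ℕ.<⇒≤ (ℕ.<-≤-trans (ih (s≤s (ℕ.m∸n≤m k i)))
                                                      (ℕ.^-monoʳ-≤ C (s≤s (ℕ.m∸n≤m k i))))))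

  -- The factor suc S > Σ ∣B i∣ absorbs the B-weighted sums of numerals in R-bound.
  SmallDigits : ℕ → ℕ → Set
  SmallDigits X m = ∀ k → k ℕ.≤ m → suc S ℕ.* suc (t k) ℕ.< X

  SmallDigits-mono : ∀ {X m m′} → m ℕ.≤ m′ → SmallDigits X m′ → SmallDigits X m
  SmallDigits-mono m≤m′ small k k≤m = small k (ℕ.≤-trans k≤m m≤m′)

  S<X : ∀ {X m} → SmallDigits X m → S ℕ.< X
  S<X small = ℕ.<-≤-trans (ℕ.n<1+n S) (ℕ.≤-trans (ℕ.m≤m*n (suc S) (suc (t 0))) (ℕ.<⇒≤ (small 0 z≤n)))

  1≤X : ∀ {X m} → SmallDigits X m → 1 ℕ.≤ X
  1≤X small = ℕ.≤-trans (s≤s z≤n) (S<X small)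

  digit-small : ∀ {X m} → SmallDigits X m → ∀ k → k ℕ.≤ m → suc S ℕ.* t k ℕ.< X
  digit-small small k k≤m = ℕ.≤-<-trans (ℕ.*-monoʳ-≤ (suc S) (ℕ.n≤1+n (t k))) (small k k≤m)

  R-bound : ∀ M X → SmallDigits X (M ℕ.+ d) → suc S ℕ.* ∣ R M (+ X) ∣ ℕ.≤ S ℕ.* X ℕ.^ d
  R-bound M X small = begin
    suc S ℕ.* ∣ R M (+ X) ∣
      ≡⟨ ℤ.abs-* (+ suc S) (R M (+ X)) ⟨
    ∣ + suc S * R M (+ X) ∣
      ≡⟨ cong (λ r → ∣ + suc S * r ∣) (R≡numerals M X) ⟩
    ∣ + suc S * sumTo d (λ i → B i * + n i) ∣
      ≡⟨ cong ∣_∣ (sumTo-*ˡ d (+ suc S) (λ i → B i * + n i)) ⟨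
    ∣ sumTo d (λ i → + suc S * (B i * + n i)) ∣
      ≤⟨ ∣sumTo∣≤ d _ (λ i → ∣ B i ∣) term-bound ⟩
    S ℕ.* X ℕ.^ d
      ∎
    where
    open ℕ.≤-Reasoning
    n : ℕ → ℕ
    n i = numeral (λ l → t (M ℕ.+ l)) (d ∸ i) X
    swap : ∀ k b m → k ℕ.* (b ℕ.* m) ≡ b ℕ.* (k ℕ.* m)
    swap = ℕ-solve-∀
    term-bound : ∀ i → i ℕ.≤ d → ∣ + suc S * (B i * + n i) ∣ ℕ.≤ ∣ B i ∣ ℕ.* X ℕ.^ d
    term-bound i _ = begin
      ∣ + suc S * (B i * + n i) ∣       ≡⟨ ℤ.abs-* (+ suc S) (B i * + n i) ⟩
      suc S ℕ.* ∣ B i * + n i ∣         ≡⟨ cong (suc S ℕ.*_) (ℤ.abs-* (B i) (+ n i)) ⟩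
      suc S ℕ.* (∣ B i ∣ ℕ.* n i)       ≡⟨ swap (suc S) ∣ B i ∣ (n i) ⟩
      ∣ B i ∣ ℕ.* (suc S ℕ.* n i)       ≤⟨ ℕ.*-monoʳ-≤ ∣ B i ∣ (ℕ.<⇒≤ (ℕ.<-≤-trans numeral-small
                                             (ℕ.^-monoʳ-≤ X {{ℕ.>-nonZero (1≤X small)}} (ℕ.m∸n≤m d i)))) ⟩
      ∣ B i ∣ ℕ.* X ℕ.^ d               ∎
      where
      numeral-small : suc S ℕ.* n i ℕ.< X ℕ.^ (d ∸ i)
      numeral-small = K*numeral<X^L (λ l → t (M ℕ.+ l)) (d ∸ i) X (suc S) λ l _ l≤d∸i →
        digit-small small (M ℕ.+ l) (ℕ.+-monoʳ-≤ M (ℕ.≤-trans l≤d∸i (ℕ.m∸n≤m d i)))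

  R+numeral<X^d : ∀ M X → SmallDigits X (d ℕ.+ M ℕ.+ d) →
                  ∣ R (d ℕ.+ M) (+ X) ∣ ℕ.+ numeral (λ l → t (M ℕ.+ l)) d X ℕ.< X ℕ.^ d
  R+numeral<X^d M X small = ℕ.*-cancelˡ-< (suc S) _ _ (begin-strict
    suc S ℕ.* (∣ R (d ℕ.+ M) (+ X) ∣ ℕ.+ n)
      ≡⟨ ℕ.*-distribˡ-+ (suc S) ∣ R (d ℕ.+ M) (+ X) ∣ n ⟩
    suc S ℕ.* ∣ R (d ℕ.+ M) (+ X) ∣ ℕ.+ suc S ℕ.* n
      <⟨ ℕ.+-mono-≤-< (R-bound (d ℕ.+ M) X small) numeral-small ⟩
    S ℕ.* X ℕ.^ d ℕ.+ X ℕ.^ d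
      ≡⟨ ℕ.+-comm (S ℕ.* X ℕ.^ d) (X ℕ.^ d) ⟩
    suc S ℕ.* X ℕ.^ d
      ∎)
    where
    open ℕ.≤-Reasoning
    n : ℕ
    n = numeral (λ l → t (M ℕ.+ l)) d X
    numeral-small : suc S ℕ.* n ℕ.< X ℕ.^ d
    numeral-small = K*numeral<X^L (λ l → t (M ℕ.+ l)) d X (suc S) λ l _ l≤d →
      digit-small small (M ℕ.+ l)
        (ℕ.≤-trans (ℕ.m≤n+m (M ℕ.+ l) d) (ℕ.≤-trans (ℕ.+-monoʳ-≤ d (ℕ.+-monoʳ-≤ M l≤d))
                                                     (ℕ.≤-reflexive (sym (ℕ.+-assoc d M d)))))

  B̃-pos : ∀ X → S ℕ.< X → + 0 < B̃ (+ X)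
  B̃-pos X S<X = subst (+ 0 <_) (sym B̃≡X^d+E) (∣i∣<p⇒0<p+i (X ℕ.^ d) E ∣E∣<X^d)
    where
    x : ℤ
    x = + X
    E : ℤ
    E = evalRev d′ (λ i → B (suc i)) x
    B̃≡X^d+E : B̃ x ≡ + (X ℕ.^ d) + E
    B̃≡X^d+E = trans (sumTo-suc d′ _)
      (cong (_+ E) (trans (cong (_* x ^ d) B₀≡1) (trans (ℤ.*-identityˡ (x ^ d)) (sym (pos-^ X d)))))
    instance
      X≢0 : ℕ.NonZero X
      X≢0 = ℕ.>-nonZero (ℕ.m<n⇒0<n S<X)
    term-bound : ∀ i → i ℕ.≤ d′ → ∣ B (suc i) * x ^ (d′ ∸ i) ∣ ℕ.≤ ∣ B (suc i) ∣ ℕ.* X ℕ.^ d′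
    term-bound i _ = begin
      ∣ B (suc i) * x ^ (d′ ∸ i) ∣          ≡⟨ ℤ.abs-* (B (suc i)) (x ^ (d′ ∸ i)) ⟩
      ∣ B (suc i) ∣ ℕ.* ∣ x ^ (d′ ∸ i) ∣    ≡⟨ cong (λ y → ∣ B (suc i) ∣ ℕ.* ∣ y ∣) (pos-^ X (d′ ∸ i)) ⟨
      ∣ B (suc i) ∣ ℕ.* X ℕ.^ (d′ ∸ i)      ≤⟨ ℕ.*-monoʳ-≤ ∣ B (suc i) ∣
                                                 (ℕ.^-monoʳ-≤ X (ℕ.m∸n≤m d′ i)) ⟩
      ∣ B (suc i) ∣ ℕ.* X ℕ.^ d′            ∎
      where open ℕ.≤-Reasoning
    ∣E∣<X^d : ∣ E ∣ ℕ.< X ℕ.^ d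
    ∣E∣<X^d = begin-strict
      ∣ E ∣                                       ≤⟨ ∣sumTo∣≤ d′ _ (λ i → ∣ B (suc i) ∣) term-bound ⟩
      sumℕ d′ (λ i → ∣ B (suc i) ∣) ℕ.* X ℕ.^ d′  ≤⟨ ℕ.*-monoˡ-≤ (X ℕ.^ d′)
                                                                 (ℕ.≤-trans (sumℕ-shift _ d′) (Σ∣B∣≤S d)) ⟩
      S ℕ.* X ℕ.^ d′                              <⟨ ℕ.*-monoˡ-< (X ℕ.^ d′) {{ℕ.m^n≢0 X d′}} S<X ⟩
      X ℕ.* X ℕ.^ d′                              ∎
      where open ℕ.≤-Reasoning

  t≡0-before-zeros : ∀ m → (∀ l → 1 ℕ.≤ l → l ℕ.≤ d → t (m ℕ.+ l) ≡ 0) → t m ≡ 0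
  t≡0-before-zeros m zeros =
    ℤ.+-injective (fromInj₂ (⊥-elim ∘ B-top≢0) (ℤ.i*j≡0⇒i≡0∨j≡0 (B d) B-top*T≡0))
    where
    F : ℕ → ℤ
    F i = B i * T (d ℕ.+ m ∸ i)
    lower-zero : ∀ i → i ℕ.< d → F i ≡ + 0
    lower-zero i i<d = begin
      B i * T (d ℕ.+ m ∸ i)       ≡⟨ cong (λ k → B i * T k)
                                           (trans (ℕ.+-∸-comm m (ℕ.<⇒≤ i<d)) (ℕ.+-comm (d ∸ i) m)) ⟩
      B i * T (m ℕ.+ (d ∸ i))     ≡⟨ cong (λ k → B i * + k) (zeros (d ∸ i) (ℕ.m<n⇒0<n∸m i<d) (ℕ.m∸n≤m d i)) ⟩
      B i * + 0                   ≡⟨ ℤ.*-zeroʳ (B i) ⟩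
      + 0                         ∎
      where open ≡-Reasoning
    upper-zero : ∀ i → d ℕ.< i → F i ≡ + 0
    upper-zero i d<i = trans (cong (_* T (d ℕ.+ m ∸ i)) (B-vanish i d<i)) (ℤ.*-zeroˡ (T (d ℕ.+ m ∸ i)))
    B-top*T≡0 : B d * T m ≡ + 0
    B-top*T≡0 = begin
      B d * T m                   ≡⟨ cong (λ k → B d * T k) (ℕ.m+n∸m≡n d m) ⟨
      F d                         ≡⟨ sumTo-last d lower-zero ⟨
      sumTo d F                   ≡⟨ sumTo-vanishing F upper-zero (ℕ.m≤m+n d m) ⟨
      sumTo (d ℕ.+ m) F           ≡⟨ gf (d ℕ.+ m) ⟩
      A (d ℕ.+ m)                 ≡⟨ A-vanish (d ℕ.+ m) (ℕ.m≤m+n d m) ⟩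
      + 0                         ∎
      where open ≡-Reasoning

  no-zero-window : ∀ m → ¬ (∀ l → 1 ℕ.≤ l → l ℕ.≤ d → t (m ℕ.+ l) ≡ 0)
  no-zero-window zero    zeros = ℤ.<-irrefl refl (subst (+ 0 <_) (trans (sym T₀≡A₀) (cong +_ t₀≡0)) A₀>0)
    where
    t₀≡0 : t 0 ≡ 0
    t₀≡0 = t≡0-before-zeros 0 zeros
  no-zero-window (suc m) zeros = no-zero-window m shifted
    where
    shifted : ∀ l → 1 ℕ.≤ l → l ℕ.≤ d → t (m ℕ.+ l) ≡ 0
    shifted (suc zero)    _ _   = trans (cong t (ℕ.+-comm m 1)) (t≡0-before-zeros (suc m) zeros)
    shifted (suc (suc l)) _ l≤d = trans (cong t (ℕ.+-suc m (suc l))) (zeros (suc l) (s≤s z≤n) (ℕ.<⇒≤ l≤d))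

  d+M+d≤d+[d+M]+d : ∀ M → d ℕ.+ M ℕ.+ d ℕ.≤ d ℕ.+ (d ℕ.+ M) ℕ.+ d
  d+M+d≤d+[d+M]+d M = ℕ.+-monoˡ-≤ d (ℕ.+-monoʳ-≤ d (ℕ.m≤n+m M d))

  R-nonneg : ∀ M X → SmallDigits X (d ℕ.+ M ℕ.+ d) → + 0 ≤ R M (+ X)
  R-nonneg M X small =
    p*u≡v+w⇒0≤u (X ℕ.^ d) {R M (+ X)} {R (d ℕ.+ M) (+ X)} (R-shift d M X)
      (ℕ.≤-<-trans (ℕ.m≤m+n _ _) (R+numeral<X^d M X small))
      (0≤i⇒0≤i*n _ (ℤ.<⇒≤ (B̃-pos X (S<X small))))

  R<B̃ : ∀ M X → SmallDigits X (d ℕ.+ M ℕ.+ d) → R M (+ X) < B̃ (+ X)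
  R<B̃ M X small =
    p*u≡v+b*w⇒u<b (X ℕ.^ d) {R M (+ X)} {R (d ℕ.+ M) (+ X)} (R-shift d M X)
      (R+numeral<X^d M X small) (B̃-pos X (S<X small))

  R≡0⇒next-terms≡0 : ∀ M X → SmallDigits X (d ℕ.+ (d ℕ.+ M) ℕ.+ d) → R M (+ X) ≡ + 0 →
                     ∀ l → 1 ℕ.≤ l → l ℕ.≤ d → t (M ℕ.+ l) ≡ 0
  R≡0⇒next-terms≡0 M X small R≡0 l 1≤l l≤d =
    ℕ.n≤0⇒n≡0 (subst (t (M ℕ.+ l) ℕ.≤_) numeral≡0 (digit≤numeral _ d (1≤X small) 1≤l l≤d))
    where
    numeral≡0 : numeral (λ l → t (M ℕ.+ l)) d X ≡ 0
    numeral≡0 = v+b*w≡0⇒w≡0 (R-nonneg (d ℕ.+ M) X small) (B̃-pos X (S<X small))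
                  (trans (sym (R-shift d M X)) (trans (cong (+ (X ℕ.^ d) *_) R≡0) (ℤ.*-zeroʳ (+ (X ℕ.^ d)))))

  R-pos : ∀ M X → SmallDigits X (d ℕ.+ (d ℕ.+ M) ℕ.+ d) → + 0 < R M (+ X)
  R-pos M X small = ℤ.≤∧≢⇒< (R-nonneg M X (SmallDigits-mono (d+M+d≤d+[d+M]+d M) small))
                            (λ 0≡R → no-zero-window M (R≡0⇒next-terms≡0 M X small (sym 0≡R)))

  x^N*Ã≡P*B̃+R : ∀ N x → x ^ N * Ã x ≡ P N x * B̃ x + R N x
  x^N*Ã≡P*B̃+R N x = split (x ^ N * Ã x) (B̃ x) (P N x)
    where
    split : ∀ a b p → a ≡ p * b + (a - b * p)
    split = solve-∀

  x^N*Ã-mod-B̃ : ∀ N X → SmallDigits X (d ℕ.+ N ℕ.+ d) →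
                modℤ ((+ X) ^ N * Ã (+ X)) (B̃ (+ X)) ≡ R N (+ X)
  x^N*Ã-mod-B̃ N X small = trans (cong (λ y → modℤ y (B̃ (+ X))) (x^N*Ã≡P*B̃+R N (+ X)))
                                (modℤ-unique (P N (+ X)) (R-nonneg N X small) (R<B̃ N X small))

  -x^N*Ã-mod-B̃ : ∀ N X → SmallDigits X (d ℕ.+ (d ℕ.+ N) ℕ.+ d) →
                 modℤ (- ((+ X) ^ N * Ã (+ X))) (B̃ (+ X)) ≡ B̃ (+ X) - R N (+ X)
  -x^N*Ã-mod-B̃ N X small =
    trans (cong (λ y → modℤ y (B̃ x)) negated-division) (modℤ-unique (- P N x - + 1) 0≤B̃-R B̃-R<B̃)
    where
    x : ℤ
    x = + X
    rearrange : ∀ p b r → - (p * b + r) ≡ (- p - + 1) * b + (b - r)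
    rearrange = solve-∀
    negated-division : - (x ^ N * Ã x) ≡ (- P N x - + 1) * B̃ x + (B̃ x - R N x)
    negated-division = trans (cong -_ (x^N*Ã≡P*B̃+R N x)) (rearrange (P N x) (B̃ x) (R N x))
    0≤B̃-R : + 0 ≤ B̃ x - R N x
    0≤B̃-R = ℤ.i≤j⇒0≤j-i (ℤ.<⇒≤ (R<B̃ N X (SmallDigits-mono (d+M+d≤d+[d+M]+d N) small)))
    B̃-R<B̃ : B̃ x - R N x < B̃ x
    B̃-R<B̃ = subst (B̃ x - R N x <_) (ℤ.+-identityʳ (B̃ x))
                   (ℤ.+-monoʳ-< (B̃ x) (ℤ.neg-mono-< (R-pos N X small)))

  R-mod-x : ∀ N X → SmallDigits X (d ℕ.+ suc N ℕ.+ d) → B d < + 0 →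
            modℤ (R (suc N) (+ X)) (+ X) ≡ + ∣ B d ∣ * T (suc N)
  R-mod-x N X small B-top<0 =
    trans (cong (λ y → modℤ y x) R≡Q*x+coefficient)
          (modℤ-unique Q (0≤i⇒0≤i*n {+ ∣ B d ∣} (t n) (+≤+ z≤n)) coefficient<X)
    where
    n : ℕ
    n = suc N
    x : ℤ
    x = + X
    Q : ℤ
    Q = R N x - evalRev d′ B x * T n
    negate : ∀ a b s → a - b * s ≡ a + - b * s
    negate = solve-∀
    R≡Q*x+coefficient : R n x ≡ Q * x + + ∣ B d ∣ * T n
    R≡Q*x+coefficient = trans (R-suc-residue N x)
      (trans (negate (Q * x) (B d) (T n)) (cong (λ b → Q * x + b * T n) (i<0⇒-i≡+∣i∣ B-top<0)))
    coefficient<X : + ∣ B d ∣ * T n < x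
    coefficient<X = subst (_< x) (ℤ.pos-* ∣ B d ∣ (t n)) (+<+ (ℕ.≤-<-trans
      (ℕ.*-monoˡ-≤ (t n) (ℕ.≤-trans (∣B∣≤S d) (ℕ.n≤1+n S)))
      (digit-small small n (ℕ.≤-trans (ℕ.m≤n+m n d) (ℕ.m≤m+n (d ℕ.+ n) d)))))

  B̃-R-mod-x : ∀ N X → SmallDigits X (d ℕ.+ suc N ℕ.+ d) → + 0 < B d →
              modℤ (B̃ (+ X) - R (suc N) (+ X)) (+ X) ≡ B d * (T (suc N) + + 1)
  B̃-R-mod-x N X small B-top>0 =
    trans (cong (λ y → modℤ y x) B̃-R≡Q*x+coefficient)
          (modℤ-unique Q (subst (+ 0 ≤_) (sym coefficient≡) (+≤+ z≤n)) coefficient<X)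
    where
    n : ℕ
    n = suc N
    x : ℤ
    x = + X
    W : ℤ
    W = evalRev d′ B x
    Q : ℤ
    Q = W - (R N x - W * T n)
    rearrange : ∀ w x b r s → w * x + b - ((r - w * s) * x - b * s) ≡ (w - (r - w * s)) * x + b * (s + + 1)
    rearrange = solve-∀
    B̃-R≡Q*x+coefficient : B̃ x - R n x ≡ Q * x + B d * (T n + + 1)
    B̃-R≡Q*x+coefficient =
      trans (cong₂ _-_ (B̃-residue x) (R-suc-residue N x)) (rearrange W x (B d) (R N x) (T n))
    coefficient≡ : B d * (T n + + 1) ≡ + (∣ B d ∣ ℕ.* suc (t n))
    coefficient≡ = trans (cong₂ _*_ (sym (ℤ.0≤i⇒+∣i∣≡i (ℤ.<⇒≤ B-top>0)))
                                    (trans (sym (ℤ.pos-+ (t n) 1)) (cong +_ (ℕ.+-comm (t n) 1))))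
                         (sym (ℤ.pos-* ∣ B d ∣ (suc (t n))))
    coefficient<X : B d * (T n + + 1) < x
    coefficient<X = subst (_< x) (sym coefficient≡) (+<+ (ℕ.≤-<-trans
      (ℕ.*-monoˡ-≤ (suc (t n)) (ℕ.≤-trans (∣B∣≤S d) (ℕ.n≤1+n S)))
      (small n (ℕ.≤-trans (ℕ.m≤n+m n d) (ℕ.m≤m+n (d ℕ.+ n) d)))))

  e : ℕ
  e = suc (suc S ℕ.* C ℕ.^ suc (d ℕ.+ d ℕ.+ d)) ℕ.* C

  e^n-small : ∀ N → SmallDigits (e ℕ.^ suc N) (d ℕ.+ (d ℕ.+ suc N) ℕ.+ d)
  e^n-small N k k≤ = begin-strict
    suc S ℕ.* suc (t k)                  ≤⟨ ℕ.*-monoʳ-≤ (suc S) (t<C^ k) ⟩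
    suc S ℕ.* C ℕ.^ suc k                ≤⟨ ℕ.*-monoʳ-≤ (suc S) (ℕ.^-monoʳ-≤ C (s≤s k≤3d+n)) ⟩
    suc S ℕ.* C ℕ.^ (m ℕ.+ suc N)        ≡⟨ cong (suc S ℕ.*_) (ℕ.^-distribˡ-+-* C m (suc N)) ⟩
    suc S ℕ.* (C ℕ.^ m ℕ.* C ℕ.^ suc N)  ≡⟨ ℕ.*-assoc (suc S) (C ℕ.^ m) (C ℕ.^ suc N) ⟨
    suc S ℕ.* C ℕ.^ m ℕ.* C ℕ.^ suc N    <⟨ a*c^n<[[1+a]*c]^n (suc S ℕ.* C ℕ.^ m) (H ℕ.+ S) N ⟩
    e ℕ.^ suc N                          ∎
    where
    open ℕ.≤-Reasoning
    m : ℕ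
    m = suc (d ℕ.+ d ℕ.+ d)
    reassociate : ∀ d n → d ℕ.+ (d ℕ.+ n) ℕ.+ d ≡ d ℕ.+ d ℕ.+ d ℕ.+ n
    reassociate = ℕ-solve-∀
    k≤3d+n : k ℕ.≤ d ℕ.+ d ℕ.+ d ℕ.+ suc N
    k≤3d+n = ℕ.≤-trans k≤ (ℕ.≤-reflexive (reassociate d (suc N)))

  power-of-power : ∀ n → + (e ℕ.^ (n ℕ.* n)) ≡ (+ (e ℕ.^ n)) ^ n
  power-of-power n = trans (cong +_ (sym (ℕ.^-*-assoc e n n))) (pos-^ (e ℕ.^ n) n)

  e-neg-formula : B d < + 0 → ∀ n → 1 ℕ.≤ n →
    + 0 < B̃ (+ (e ℕ.^ n)) ×
    + ∣ B d ∣ * + (t n) ≡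
    modℤ (modℤ (+ (e ℕ.^ (n ℕ.* n)) * Ã (+ (e ℕ.^ n))) (B̃ (+ (e ℕ.^ n)))) (+ (e ℕ.^ n))
  e-neg-formula B-top<0 (suc N) _ = B̃-pos X (S<X small) , (begin
    + ∣ B d ∣ * T n                                   ≡⟨ R-mod-x N X small′ B-top<0 ⟨
    modℤ (R n x) x                                    ≡⟨ cong (λ y → modℤ y x) (x^N*Ã-mod-B̃ n X small′) ⟨
    modℤ (modℤ (x ^ n * Ã x) (B̃ x)) x                 ≡⟨ cong (λ y → modℤ (modℤ (y * Ã x) (B̃ x)) x)
                                                              (power-of-power n) ⟨
    modℤ (modℤ (+ (e ℕ.^ (n ℕ.* n)) * Ã x) (B̃ x)) x   ∎)
    where
    open ≡-Reasoning
    n X : ℕ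
    n = suc N
    X = e ℕ.^ n
    x : ℤ
    x = + X
    small : SmallDigits X (d ℕ.+ (d ℕ.+ n) ℕ.+ d)
    small = e^n-small N
    small′ : SmallDigits X (d ℕ.+ n ℕ.+ d)
    small′ = SmallDigits-mono (d+M+d≤d+[d+M]+d n) small

  e-pos-formula : + 0 < B d → ∀ n → 1 ℕ.≤ n →
    + 0 < B̃ (+ (e ℕ.^ n)) ×
    B d * (+ (t n) + + 1) ≡
    modℤ (modℤ (- (+ (e ℕ.^ (n ℕ.* n)) * Ã (+ (e ℕ.^ n)))) (B̃ (+ (e ℕ.^ n)))) (+ (e ℕ.^ n))
  e-pos-formula B-top>0 (suc N) _ = B̃-pos X (S<X small) , (begin
    B d * (T n + + 1)                                    ≡⟨ B̃-R-mod-x N X small′ B-top>0 ⟨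
    modℤ (B̃ x - R n x) x                                 ≡⟨ cong (λ y → modℤ y x) (-x^N*Ã-mod-B̃ n X small) ⟨
    modℤ (modℤ (- (x ^ n * Ã x)) (B̃ x)) x                ≡⟨ cong (λ y → modℤ (modℤ (- (y * Ã x)) (B̃ x)) x)
                                                                 (power-of-power n) ⟨
    modℤ (modℤ (- (+ (e ℕ.^ (n ℕ.* n)) * Ã x)) (B̃ x)) x  ∎)
    where
    open ≡-Reasoning
    n X : ℕ
    n = suc N
    X = e ℕ.^ n
    x : ℤ
    x = + X
    small : SmallDigits X (d ℕ.+ (d ℕ.+ n) ℕ.+ d)
    small = e^n-small N
    small′ : SmallDigits X (d ℕ.+ n ℕ.+ d)
    small′ = SmallDigits-mono (d+M+d≤d+[d+M]+d n) small

theorem3p1 : (d : ℕ) (A B : ℕ → ℤ) (t : ℕ → ℕ)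
    → 1 ℕ.≤ d
    → B 0 ≡ + 1
    → B d ≢ + 0
    → (∀ i → d ℕ.< i → B i ≡ + 0)
    → (∀ i → d ℕ.≤ i → A i ≡ + 0)
    → + 0 < A 0
    → GenFun t A B
    → Σ ℕ (λ c → 1 ℕ.≤ c × (∀ n → 1 ℕ.≤ n →
          evalRev d B (+ (c ℕ.^ n)) ≢ + 0
          × + (t n) ≡ modℤ (floorDiv (+ (c ℕ.^ (n ℕ.* n)) * evalRev d A (+ (c ℕ.^ n)))
                                     (evalRev d B (+ (c ℕ.^ n))))
                           (+ (c ℕ.^ n))))
    → (B d < + 0 → Σ ℕ (λ e → 1 ℕ.≤ e × (∀ n → 1 ℕ.≤ n →
          + 0 < evalRev d B (+ (e ℕ.^ n))
          × + ∣ B d ∣ * + (t n)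
              ≡ modℤ (modℤ (+ (e ℕ.^ (n ℕ.* n)) * evalRev d A (+ (e ℕ.^ n)))
                           (evalRev d B (+ (e ℕ.^ n))))
                     (+ (e ℕ.^ n)))))
      × (+ 0 < B d → Σ ℕ (λ e → 1 ℕ.≤ e × (∀ n → 1 ℕ.≤ n →
          + 0 < evalRev d B (+ (e ℕ.^ n))
          × B d * (+ (t n) + + 1)
              ≡ modℤ (modℤ (- (+ (e ℕ.^ (n ℕ.* n)) * evalRev d A (+ (e ℕ.^ n))))
                           (evalRev d B (+ (e ℕ.^ n))))
                     (+ (e ℕ.^ n)))))
theorem3p1 zero     _ _ _ ()
theorem3p1 (suc d′) A B t _ B₀≡1 B-top≢0 B-vanish A-vanish A₀>0 gf _ =
  (λ B-top<0 → e , s≤s z≤n , e-neg-formula B-top<0) ,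
  (λ B-top>0 → e , s≤s z≤n , e-pos-formula B-top>0)
  where open Recurrence d′ A B t B₀≡1 B-top≢0 B-vanish A-vanish A₀>0 gf
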